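{- Every monomorphism of $\mathbb{DCL}[ZF]$ belongs to the class $\mathcal{S}$ of small maps.
   Context: $ZF$ is Zermelo–Fraenkel set theory (classical first-order theory with equality, language with one binary relation symbol $\in$). The syntactic category $\mathbb{ZF}$ has as objects formulas in context $\{x_1,\dots,x_n\mid P\}$ ($x_i$ distinct variables, possibly none, $P$ a formula with free variables among them); an arrow $\{\mathbf{x}\mid P\}\to\{\mathbf{y}\mid Q\}$ is an equivalence class $[\{\mathbf{x}',\mathbf{y}'\mid F\}]_{\equiv}$ of formulas in context ($\mathbf{x}',\mathbf{y}'$ of the same lengths as $\mathbf{x},\mathbf{y}$) with $F\vdash_{ZF}P[\mathbf{x}'/\mathbf{x}]\wedge Q[\mathbf{y}'/\mathbf{y}]$, $F\wedge F[\mathbf{y}''/\mathbf{y}']\vdash_{ZF}\mathbf{y}'=\mathbf{y}''$, $P[\mathbf{x}'/\mathbf{x}]\vdash_{ZF}\exists\mathbf{y}'F$, two such being equivalent iff $\vdash_{ZF}F\leftrightarrow F'[\mathbf{x}'/\mathbf{x}'',\mathbf{y}'/\mathbf{y}'']$; composition of $[\{\mathbf{x}',\mathbf{y}'\mid F\}]$ and $[\{\mathbf{y}',\mathbf{z}'\mid F'\}]$ is $[\{\mathbf{x}',\mathbf{z}'\mid\exists\mathbf{y}'(F\wedge F')\}]$. $\mathbb{DCL}[ZF]$ is the full subcategory of $\mathbb{ZF}$ on objects $\{x\mid P\}$ with exactly one variable. The class $\mathcal{S}$ of small maps in $\mathbb{DCL}[ZF]$: an arrow $[\{x,y\mid F\}]_{\equiv}:\{x\mid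 P\}\to\{y\mid Q\}$ is in $\mathcal{S}$ iff $\vdash_{ZF}\forall y\exists z\forall x(F(x,y)\leftrightarrow x\in z)$. -}

module Defs where

open import Data.Nat using (ℕ; zero; suc; _<_; _+_)
open import Data.Product using (_×_)
open import Data.Unit using (⊤)

-- Syntax of first-order set theory (language {∈}, with equality),
-- variables as de Bruijn indices (var n ↦ n).  The only terms are variables.

infixr 4 _⇒_
infix 7 _∈'_ _≐_

data Fm : Set where
  _∈'_ : ℕ → ℕ → Fm
  _≐_  : ℕ → ℕ → Fm
  ⊥'   : Fm
  _⇒_  : Fm → Fm → Fm
  ∀'   : Fm → Fm

¬' : Fm → Fm
¬' φ = φ ⇒ ⊥'

infixr 6 _∧'_
infixr 5 _∨'_
infix 3 _⇔_

_∧'_ : Fm → Fm → Fm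
φ ∧' ψ = ¬' (φ ⇒ ¬' ψ)

_∨'_ : Fm → Fm → Fm
φ ∨' ψ = ¬' φ ⇒ ψ

_⇔_ : Fm → Fm → Fm
φ ⇔ ψ = (φ ⇒ ψ) ∧' (ψ ⇒ φ)

∃' : Fm → Fm
∃' φ = ¬' (∀' (¬' φ))

lift : (ℕ → ℕ) → ℕ → ℕ
lift ρ zero    = zero
lift ρ (suc n) = suc (ρ n)

rename : (ℕ → ℕ) → Fm → Fm
rename ρ (i ∈' j) = ρ i ∈' ρ j
rename ρ (i ≐ j)  = ρ i ≐ ρ j
rename ρ ⊥'       = ⊥'
rename ρ (φ ⇒ ψ)  = rename ρ φ ⇒ rename ρ ψ
rename ρ (∀' φ)   = ∀' (rename (lift ρ) φ)

inst : ℕ → ℕ → ℕ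
inst t zero    = t
inst t (suc n) = n

FreeBelow : ℕ → Fm → Set
FreeBelow k (i ∈' j) = (i < k) × (j < k)
FreeBelow k (i ≐ j)  = (i < k) × (j < k)
FreeBelow k ⊥'       = ⊤
FreeBelow k (φ ⇒ ψ)  = FreeBelow k φ × FreeBelow k ψ
FreeBelow k (∀' φ)   = FreeBelow (suc k) φ

-- Extensionality: ∀x∀y(∀z(z∈x ↔ z∈y) → x=y)
Ext : Fm
Ext = ∀' (∀' (∀' ((0 ∈' 2) ⇔ (0 ∈' 1)) ⇒ (1 ≐ 0)))

-- Foundation: ∀x(∃y y∈x → ∃y(y∈x ∧ ∀z(z∈y → ¬ z∈x)))
Found : Fm
Found = ∀' (∃' (0 ∈' 1) ⇒ ∃' ((0 ∈' 1) ∧' ∀' ((0 ∈' 1) ⇒ ¬' (0 ∈' 2))))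

-- Pairing: ∀x∀y∃z(x∈z ∧ y∈z)
Pair : Fm
Pair = ∀' (∀' (∃' ((2 ∈' 0) ∧' (1 ∈' 0))))

-- Union: ∀x∃u∀y∀w(w∈y ∧ y∈x → w∈u)
Union : Fm
Union = ∀' (∃' (∀' (∀' (((0 ∈' 1) ∧' (1 ∈' 3)) ⇒ (0 ∈' 2)))))

-- Power set: ∀x∃p∀y(∀z(z∈y → z∈x) → y∈p)
Power : Fm
Power = ∀' (∃' (∀' (∀' ((0 ∈' 1) ⇒ (0 ∈' 3)) ⇒ (0 ∈' 1))))

-- Infinity: ∃I(∃e(e∈I ∧ ∀w ¬w∈e) ∧ ∀y(y∈I → ∃s(s∈I ∧ ∀w(w∈s ↔ (w∈y ∨ w=y)))))
Inf : Fm
Inf = ∃' ( ∃' ((0 ∈' 1) ∧' ∀' (¬' (0 ∈' 1)))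
        ∧' ∀' ((0 ∈' 1) ⇒ ∃' ((0 ∈' 2) ∧' ∀' ((0 ∈' 1) ⇔ ((0 ∈' 2) ∨' (0 ≐ 2))))))

-- Separation, for φ(x, p₀, p₁, …) (var 0 = x, var (suc n) = parameter n):
--   ∀a∃b∀x(x∈b ↔ (x∈a ∧ φ))
sepρ : ℕ → ℕ
sepρ zero    = 0
sepρ (suc n) = suc (suc (suc n))

Sep : Fm → Fm
Sep φ = ∀' (∃' (∀' ((0 ∈' 1) ⇔ ((0 ∈' 2) ∧' rename sepρ φ))))

-- Replacement, for φ(y, x, p₀, p₁, …) (var 0 = y, var 1 = x, var (2+n) = parameter n):
--   ∀A(∀x(x∈A → ∃y(φ(x,y) ∧ ∀y'(φ(x,y') → y'=y))) → ∃Y∀x(x∈A → ∃y(y∈Y ∧ φ(x,y))))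
replρa : ℕ → ℕ
replρa zero          = 0
replρa (suc zero)    = 1
replρa (suc (suc n)) = 3 + n

replρb : ℕ → ℕ
replρb zero          = 0
replρb (suc zero)    = 2
replρb (suc (suc n)) = 4 + n

replρc : ℕ → ℕ
replρc zero          = 0
replρc (suc zero)    = 1
replρc (suc (suc n)) = 4 + n

Repl : Fm → Fm
Repl φ = ∀' ( ∀' ((0 ∈' 1) ⇒ ∃' (rename replρa φ ∧' ∀' (rename replρb φ ⇒ (0 ≐ 1))))
            ⇒ ∃' (∀' ((0 ∈' 2) ⇒ ∃' ((0 ∈' 2) ∧' rename replρc φ))) )

data ZFAxiom : Fm → Set where
  ax-ext   : ZFAxiom Ext
  ax-found : ZFAxiom Found
  ax-pair  : ZFAxiom Pair
  ax-union : ZFAxiom Union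
  ax-power : ZFAxiom Power
  ax-inf   : ZFAxiom Inf
  ax-sep   : ∀ φ → ZFAxiom (Sep φ)
  ax-repl  : ∀ φ → ZFAxiom (Repl φ)

-- Provability in ZF: a Hilbert-style calculus for classical first-order
-- logic with equality (free variables read universally).

infix 2 ⊢ZF_

data ⊢ZF_ : Fm → Set where
  zf    : ∀ {φ} → ZFAxiom φ → ⊢ZF φ
  ax-K  : ∀ φ ψ → ⊢ZF φ ⇒ ψ ⇒ φ
  ax-S  : ∀ φ ψ χ → ⊢ZF (φ ⇒ ψ ⇒ χ) ⇒ (φ ⇒ ψ) ⇒ φ ⇒ χ
  ax-DN : ∀ φ → ⊢ZF ¬' (¬' φ) ⇒ φ
  ax-∀E : ∀ φ t → ⊢ZF ∀' φ ⇒ rename (inst t) φ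
  ax-∀D : ∀ φ ψ → ⊢ZF ∀' (φ ⇒ ψ) ⇒ ∀' φ ⇒ ∀' ψ
  ax-∀V : ∀ φ → ⊢ZF φ ⇒ ∀' (rename suc φ)
  eq-refl  : ∀ i → ⊢ZF i ≐ i
  eq-eq    : ∀ i j k → ⊢ZF (i ≐ j) ⇒ (i ≐ k) ⇒ (j ≐ k)
  eq-memˡ  : ∀ i j k → ⊢ZF (i ≐ j) ⇒ (i ∈' k) ⇒ (j ∈' k)
  eq-memʳ  : ∀ i j k → ⊢ZF (i ≐ j) ⇒ (k ∈' i) ⇒ (k ∈' j)
  mp    : ∀ {φ ψ} → ⊢ZF φ ⇒ ψ → ⊢ZF φ → ⊢ZF ψ
  gen   : ∀ {φ} → ⊢ZF φ → ⊢ZF ∀' φ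

-- The category DCL[ZF] (one-variable objects of the syntactic category).
-- Object {x | P}: P with free variables among {x}, x = var 0.
-- Arrow representative {x', y' | F}: F with free vars among x' = var 0, y' = var 1.

IsObject : Fm → Set
IsObject P = FreeBelow 1 P

toY : ℕ → ℕ          -- Q[y'/y] : 0 ↦ 1
toY zero    = 1
toY (suc n) = suc (suc n)

y→y'' : ℕ → ℕ        -- F[y''/y'] : 1 ↦ 2
y→y'' zero          = 0
y→y'' (suc zero)    = 2
y→y'' (suc (suc n)) = suc (suc n)

swap01 : ℕ → ℕ
swap01 zero          = 1
swap01 (suc zero)    = 0
swap01 (suc (suc n)) = suc (suc (suc n))

IsArrow : Fm → Fm → Fm → Set
IsArrow P Q F =
  FreeBelow 2 F
  × (⊢ZF F ⇒ (P ∧' rename toY Q))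
  × (⊢ZF (F ∧' rename y→y'' F) ⇒ (1 ≐ 2))
  × (⊢ZF P ⇒ ∃' (rename swap01 F))

_≡ₐ_ : Fm → Fm → Set
F ≡ₐ G = ⊢ZF F ⇔ G

-- composition: F : x → y, G : y → z  gives  ∃y (F(x,y) ∧ G(y,z))
compρ₂ : ℕ → ℕ
compρ₂ zero          = 0
compρ₂ (suc zero)    = 2
compρ₂ (suc (suc n)) = suc (suc (suc n))

_⨾_ : Fm → Fm → Fm
F ⨾ G = ∃' (rename swap01 F ∧' rename compρ₂ G)

IsMono : Fm → Fm → Fm → Set
IsMono P Q F =
  ∀ R G H → IsObject R → IsArrow R P G → IsArrow R P H →
  (G ⨾ F) ≡ₐ (H ⨾ F) → G ≡ₐ H

-- small maps: ⊢ ∀y∃z∀x(F(x,y) ↔ x∈z)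
smallρ : ℕ → ℕ
smallρ zero          = 0
smallρ (suc zero)    = 2
smallρ (suc (suc n)) = suc (suc (suc n))

IsSmall : Fm → Set
IsSmall F = ⊢ZF ∀' (∃' (∀' (rename smallρ F ⇔ (0 ∈' 1))))

-- Let F : P → Q be monic.  Its kernel pair K = {⟨a , b⟩ | a, b ∈ P, F a = F b} comes with the two
-- projections π₁, π₂ : K → P, which F equalises; so π₁ = π₂, which says that F is injective.
-- The fibre of F over y is then either empty or a singleton, hence a set by Separation.
module Submission where

open import Defs
open import Data.Bool using (Bool; true; T; _∧_)
open import Data.Bool.Properties using (T-∧)
open import Data.List using (List; []; _∷_; map)
open import Data.Nat using (ℕ; zero; suc; _+_; _<_; s≤s; z≤n; _<ᵇ_)
open import Data.Nat.Properties using (<ᵇ⇒<)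
open import Data.Product using (_×_; _,_; proj₁; proj₂)
open import Data.Sum using (_⊎_; inj₁; inj₂)
open import Data.Unit using (tt)
open import Function using (const)
open import Function.Bundles using (Equivalence)
open import Relation.Binary.PropositionalEquality using (_≡_; refl; sym; trans; cong; cong₂; subst)

rename-∘ : ∀ ρ σ τ φ → (∀ n → ρ (σ n) ≡ τ n) → rename ρ (rename σ φ) ≡ rename τ φ
rename-∘ ρ σ τ (i ∈' j) h = cong₂ _∈'_ (h i) (h j)
rename-∘ ρ σ τ (i ≐ j)  h = cong₂ _≐_ (h i) (h j)
rename-∘ ρ σ τ ⊥'       h = refl
rename-∘ ρ σ τ (φ ⇒ ψ)  h = cong₂ _⇒_ (rename-∘ ρ σ τ φ h) (rename-∘ ρ σ τ ψ h)
rename-∘ ρ σ τ (∀' φ)   h = cong ∀' (rename-∘ (lift ρ) (lift σ) (lift τ) φ h↑)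
  where
  h↑ : ∀ n → lift ρ (lift σ n) ≡ lift τ n
  h↑ zero    = refl
  h↑ (suc n) = cong suc (h n)

rename-cong : ∀ k ρ σ φ → FreeBelow k φ → (∀ n → n < k → ρ n ≡ σ n) → rename ρ φ ≡ rename σ φ
rename-cong k ρ σ (i ∈' j) (i<k , j<k) h = cong₂ _∈'_ (h i i<k) (h j j<k)
rename-cong k ρ σ (i ≐ j)  (i<k , j<k) h = cong₂ _≐_ (h i i<k) (h j j<k)
rename-cong k ρ σ ⊥'       _           h = refl
rename-cong k ρ σ (φ ⇒ ψ)  (fφ , fψ)   h = cong₂ _⇒_ (rename-cong k ρ σ φ fφ h) (rename-cong k ρ σ ψ fψ h)
rename-cong k ρ σ (∀' φ)   fφ          h = cong ∀' (rename-cong (suc k) (lift ρ) (lift σ) φ fφ h↑)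
  where
  h↑ : ∀ n → n < suc k → lift ρ n ≡ lift σ n
  h↑ zero    _       = refl
  h↑ (suc n) (s≤s p) = cong suc (h n p)

rename-id : ∀ ρ φ → (∀ n → ρ n ≡ n) → rename ρ φ ≡ φ
rename-id ρ (i ∈' j) h = cong₂ _∈'_ (h i) (h j)
rename-id ρ (i ≐ j)  h = cong₂ _≐_ (h i) (h j)
rename-id ρ ⊥'       h = refl
rename-id ρ (φ ⇒ ψ)  h = cong₂ _⇒_ (rename-id ρ φ h) (rename-id ρ ψ h)
rename-id ρ (∀' φ)   h = cong ∀' (rename-id (lift ρ) φ h↑)
  where
  h↑ : ∀ n → lift ρ n ≡ n
  h↑ zero    = refl
  h↑ (suc n) = cong suc (h n)

freeBelow-rename : ∀ m k ρ φ → FreeBelow m φ → (∀ n → n < m → ρ n < k) → FreeBelow k (rename ρ φ)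
freeBelow-rename m k ρ (i ∈' j) (i<m , j<m) h = h i i<m , h j j<m
freeBelow-rename m k ρ (i ≐ j)  (i<m , j<m) h = h i i<m , h j j<m
freeBelow-rename m k ρ ⊥'       _           h = tt
freeBelow-rename m k ρ (φ ⇒ ψ)  (fφ , fψ)   h = freeBelow-rename m k ρ φ fφ h , freeBelow-rename m k ρ ψ fψ h
freeBelow-rename m k ρ (∀' φ)   fφ          h = freeBelow-rename (suc m) (suc k) (lift ρ) φ fφ h↑
  where
  h↑ : ∀ n → n < suc m → lift ρ n < suc k
  h↑ zero    _       = s≤s z≤n
  h↑ (suc n) (s≤s p) = s≤s (h n p)

rename-cong₁ : ∀ φ → FreeBelow 1 φ → ∀ ρ σ → ρ 0 ≡ σ 0 → rename ρ φ ≡ rename σ φ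
rename-cong₁ φ fφ ρ σ e₀ = rename-cong 1 ρ σ φ fφ h
  where
  h : ∀ n → n < 1 → ρ n ≡ σ n
  h zero    _       = e₀
  h (suc n) (s≤s ())

rename-cong₂ : ∀ φ → FreeBelow 2 φ → ∀ ρ σ → ρ 0 ≡ σ 0 → ρ 1 ≡ σ 1 → rename ρ φ ≡ rename σ φ
rename-cong₂ φ fφ ρ σ e₀ e₁ = rename-cong 2 ρ σ φ fφ h
  where
  h : ∀ n → n < 2 → ρ n ≡ σ n
  h zero          _               = e₀
  h (suc zero)    _               = e₁
  h (suc (suc n)) (s≤s (s≤s ()))

args₂ : ℕ → ℕ → ℕ → ℕ
args₂ i j zero    = i
args₂ i j (suc _) = j

rename-const-id : ∀ φ → FreeBelow 1 φ → rename (const 0) φ ≡ φ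
rename-const-id φ fφ = trans (rename-cong₁ φ fφ (const 0) (λ n → n) refl) (rename-id (λ n → n) φ (λ _ → refl))

rename-args₂-id : ∀ φ → FreeBelow 2 φ → rename (args₂ 0 1) φ ≡ φ
rename-args₂-id φ fφ = trans (rename-cong₂ φ fφ (args₂ 0 1) (λ n → n) refl refl) (rename-id (λ n → n) φ (λ _ → refl))

-- Formulas over {∈} enriched with a unary predicate symbol P· and a binary relation symbol F·,
-- interpreted by the formulas P and F.  Renaming acts on the arguments of the symbols directly,
-- so instantiating a quantifier over P· i or F· i j computes.
module Schematic (P F : Fm) where

  infix  7 _∈·_ _≐·_
  infixr 4 _⇒·_
  infixr 6 _∧·_
  infixr 5 _∨·_
  infix  3 _⇔·_

  data SFm : Set where
    _∈·_ _≐·_ : ℕ → ℕ → SFm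
    ⊥·        : SFm
    _⇒·_      : SFm → SFm → SFm
    ∀·        : SFm → SFm
    P·        : ℕ → SFm
    F·        : ℕ → ℕ → SFm

  ¬· : SFm → SFm
  ¬· φ = φ ⇒· ⊥·

  _∧·_ _∨·_ _⇔·_ : SFm → SFm → SFm
  φ ∧· ψ = ¬· (φ ⇒· ¬· ψ)
  φ ∨· ψ = ¬· φ ⇒· ψ
  φ ⇔· ψ = (φ ⇒· ψ) ∧· (ψ ⇒· φ)

  ∃· : SFm → SFm
  ∃· φ = ¬· (∀· (¬· φ))

  ⟦_⟧ : SFm → Fm
  ⟦ i ∈· j ⟧ = i ∈' j
  ⟦ i ≐· j ⟧ = i ≐ j
  ⟦ ⊥· ⟧     = ⊥'
  ⟦ φ ⇒· ψ ⟧ = ⟦ φ ⟧ ⇒ ⟦ ψ ⟧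
  ⟦ ∀· φ ⟧   = ∀' ⟦ φ ⟧
  ⟦ P· i ⟧   = rename (const i) P
  ⟦ F· i j ⟧ = rename (args₂ i j) F

  rename· : (ℕ → ℕ) → SFm → SFm
  rename· ρ (i ∈· j) = ρ i ∈· ρ j
  rename· ρ (i ≐· j) = ρ i ≐· ρ j
  rename· ρ ⊥·       = ⊥·
  rename· ρ (φ ⇒· ψ) = rename· ρ φ ⇒· rename· ρ ψ
  rename· ρ (∀· φ)   = ∀· (rename· (lift ρ) φ)
  rename· ρ (P· i)   = P· (ρ i)
  rename· ρ (F· i j) = F· (ρ i) (ρ j)

  ⟦⟧-rename : ∀ ρ φ → ⟦ rename· ρ φ ⟧ ≡ rename ρ ⟦ φ ⟧
  ⟦⟧-rename ρ (i ∈· j) = refl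
  ⟦⟧-rename ρ (i ≐· j) = refl
  ⟦⟧-rename ρ ⊥·       = refl
  ⟦⟧-rename ρ (φ ⇒· ψ) = cong₂ _⇒_ (⟦⟧-rename ρ φ) (⟦⟧-rename ρ ψ)
  ⟦⟧-rename ρ (∀· φ)   = cong ∀' (⟦⟧-rename (lift ρ) φ)
  ⟦⟧-rename ρ (P· i)   = sym (rename-∘ ρ (const i) (const (ρ i)) P (λ _ → refl))
  ⟦⟧-rename ρ (F· i j) = sym (rename-∘ ρ (args₂ i j) (args₂ (ρ i) (ρ j)) F h)
    where
    h : ∀ n → ρ (args₂ i j n) ≡ args₂ (ρ i) (ρ j) n
    h zero    = refl
    h (suc n) = refl

  freeBelowᵇ : ℕ → SFm → Bool
  freeBelowᵇ k (i ∈· j) = (i <ᵇ k) ∧ (j <ᵇ k)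
  freeBelowᵇ k (i ≐· j) = (i <ᵇ k) ∧ (j <ᵇ k)
  freeBelowᵇ k ⊥·       = true
  freeBelowᵇ k (φ ⇒· ψ) = freeBelowᵇ k φ ∧ freeBelowᵇ k ψ
  freeBelowᵇ k (∀· φ)   = freeBelowᵇ (suc k) φ
  freeBelowᵇ k (P· i)   = i <ᵇ k
  freeBelowᵇ k (F· i j) = (i <ᵇ k) ∧ (j <ᵇ k)

  both-<ᵇ : ∀ {i j k} → T ((i <ᵇ k) ∧ (j <ᵇ k)) → i < k × j < k
  both-<ᵇ {i} {j} {k} t = let (p , q) = Equivalence.to T-∧ t in <ᵇ⇒< i k p , <ᵇ⇒< j k q

  freeBelowᵇ-sound : FreeBelow 1 P → FreeBelow 2 F → ∀ k φ → T (freeBelowᵇ k φ) → FreeBelow k ⟦ φ ⟧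
  freeBelowᵇ-sound fP fF k (i ∈· j) t = both-<ᵇ t
  freeBelowᵇ-sound fP fF k (i ≐· j) t = both-<ᵇ t
  freeBelowᵇ-sound fP fF k ⊥·       t = tt
  freeBelowᵇ-sound fP fF k (φ ⇒· ψ) t =
    let (p , q) = Equivalence.to T-∧ t in freeBelowᵇ-sound fP fF k φ p , freeBelowᵇ-sound fP fF k ψ q
  freeBelowᵇ-sound fP fF k (∀· φ)   t = freeBelowᵇ-sound fP fF (suc k) φ t
  freeBelowᵇ-sound fP fF k (P· i)   t = freeBelow-rename 1 k (const i) P fP (λ _ _ → <ᵇ⇒< i k t)
  freeBelowᵇ-sound fP fF k (F· i j) t = freeBelow-rename 2 k (args₂ i j) F fF h
    where
    h : ∀ n → n < 2 → args₂ i j n < k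
    h zero    _ = proj₁ (both-<ᵇ t)
    h (suc n) _ = proj₂ (both-<ᵇ t)

  -- Γ ⊩ φ is ⊢ZF (Γₙ ⇒ … ⇒ Γ₁ ⇒ φ), with the head of Γ as the innermost hypothesis.
  discharge : List SFm → SFm → SFm
  discharge []      φ = φ
  discharge (A ∷ Γ) φ = discharge Γ (A ⇒· φ)

  infix 2 _⊩_
  record _⊩_ (Γ : List SFm) (φ : SFm) : Set where
    constructor ⟨_⟩
    field derivation : ⊢ZF ⟦ discharge Γ φ ⟧
  open _⊩_ public

  discharge-theorem : ∀ Γ φ → ⊢ZF ⟦ φ ⟧ → ⊢ZF ⟦ discharge Γ φ ⟧
  discharge-mp : ∀ Γ φ ψ → ⊢ZF ⟦ discharge Γ (φ ⇒· ψ) ⟧ → ⊢ZF ⟦ discharge Γ φ ⟧ → ⊢ZF ⟦ discharge Γ ψ ⟧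
  discharge-theorem []      φ d = d
  discharge-theorem (A ∷ Γ) φ d =
    discharge-mp Γ φ (A ⇒· φ) (discharge-theorem Γ (φ ⇒· A ⇒· φ) (ax-K ⟦ φ ⟧ ⟦ A ⟧)) (discharge-theorem Γ φ d)
  discharge-mp []      φ ψ f x = mp f x
  discharge-mp (A ∷ Γ) φ ψ f x =
    discharge-mp Γ (A ⇒· φ) (A ⇒· ψ)
      (discharge-mp Γ (A ⇒· φ ⇒· ψ) ((A ⇒· φ) ⇒· A ⇒· ψ)
        (discharge-theorem Γ ((A ⇒· φ ⇒· ψ) ⇒· (A ⇒· φ) ⇒· A ⇒· ψ) (ax-S ⟦ A ⟧ ⟦ φ ⟧ ⟦ ψ ⟧)) f) x

  ⊢⇒⊩ : ∀ {Γ φ} → ⊢ZF ⟦ φ ⟧ → Γ ⊩ φ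
  ⊢⇒⊩ {Γ} {φ} d = ⟨ discharge-theorem Γ φ d ⟩

  ⇒E : ∀ {Γ φ ψ} → Γ ⊩ φ ⇒· ψ → Γ ⊩ φ → Γ ⊩ ψ
  ⇒E {Γ} {φ} {ψ} ⟨ f ⟩ ⟨ x ⟩ = ⟨ discharge-mp Γ φ ψ f x ⟩

  ⇒I : ∀ {Γ A φ} → (A ∷ Γ) ⊩ φ → Γ ⊩ A ⇒· φ
  ⇒I ⟨ d ⟩ = ⟨ d ⟩

  ⇒I⁻¹ : ∀ {Γ A φ} → Γ ⊩ A ⇒· φ → (A ∷ Γ) ⊩ φ
  ⇒I⁻¹ ⟨ d ⟩ = ⟨ d ⟩

  weaken : ∀ {Γ φ} → [] ⊩ φ → Γ ⊩ φ
  weaken ⟨ d ⟩ = ⊢⇒⊩ d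

  wk : ∀ {Γ A φ} → Γ ⊩ φ → (A ∷ Γ) ⊩ φ
  wk {Γ} {A} {φ} d = ⇒I⁻¹ (⇒E (⊢⇒⊩ (ax-K ⟦ φ ⟧ ⟦ A ⟧)) d)

  ⊢-id : ∀ A → ⊢ZF A ⇒ A
  ⊢-id A = mp (mp (ax-S A (A ⇒ A) A) (ax-K A (A ⇒ A))) (ax-K A A)

  #0 : ∀ {Γ A} → (A ∷ Γ) ⊩ A
  #0 {Γ} {A} = ⇒I⁻¹ (⊢⇒⊩ (⊢-id ⟦ A ⟧))
  #1 : ∀ {Γ A B} → (B ∷ A ∷ Γ) ⊩ A
  #1 = wk #0
  #2 : ∀ {Γ A B C} → (C ∷ B ∷ A ∷ Γ) ⊩ A
  #2 = wk #1
  #3 : ∀ {Γ A B C D} → (D ∷ C ∷ B ∷ A ∷ Γ) ⊩ A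
  #3 = wk #2

  ¬¬E : ∀ {Γ φ} → Γ ⊩ ¬· (¬· φ) → Γ ⊩ φ
  ¬¬E {Γ} {φ} d = ⇒E (⊢⇒⊩ (ax-DN ⟦ φ ⟧)) d

  ⊥E : ∀ {Γ φ} → Γ ⊩ ⊥· → Γ ⊩ φ
  ⊥E d = ¬¬E (⇒I (wk d))

  ∧I : ∀ {Γ φ ψ} → Γ ⊩ φ → Γ ⊩ ψ → Γ ⊩ φ ∧· ψ
  ∧I a b = ⇒I (⇒E (⇒E #0 (wk a)) (wk b))

  ∧E₁ : ∀ {Γ φ ψ} → Γ ⊩ φ ∧· ψ → Γ ⊩ φ
  ∧E₁ d = ¬¬E (⇒I (⇒E (wk d) (⇒I (⊥E (⇒E #1 #0)))))

  ∧E₂ : ∀ {Γ φ ψ} → Γ ⊩ φ ∧· ψ → Γ ⊩ ψ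
  ∧E₂ d = ¬¬E (⇒I (⇒E (wk d) (⇒I #1)))

  ∨I₁ : ∀ {Γ φ ψ} → Γ ⊩ φ → Γ ⊩ φ ∨· ψ
  ∨I₁ a = ⇒I (⊥E (⇒E #0 (wk a)))

  ∨I₂ : ∀ {Γ φ ψ} → Γ ⊩ ψ → Γ ⊩ φ ∨· ψ
  ∨I₂ b = ⇒I (wk b)

  ∨E : ∀ {Γ φ ψ χ} → Γ ⊩ φ ∨· ψ → Γ ⊩ φ ⇒· χ → Γ ⊩ ψ ⇒· χ → Γ ⊩ χ
  ∨E d f g = ¬¬E (⇒I (⇒E #0 (⇒E (wk g) (⇒E (wk d) (⇒I (⇒E #1 (⇒E (wk (wk f)) #0)))))))

  excluded-middle : ∀ {Γ φ} → Γ ⊩ φ ∨· ¬· φ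
  excluded-middle = ⇒I #0

  ⇔I : ∀ {Γ φ ψ} → Γ ⊩ φ ⇒· ψ → Γ ⊩ ψ ⇒· φ → Γ ⊩ φ ⇔· ψ
  ⇔I = ∧I

  ⇔E₁ : ∀ {Γ φ ψ} → Γ ⊩ φ ⇔· ψ → Γ ⊩ φ → Γ ⊩ ψ
  ⇔E₁ d = ⇒E (∧E₁ d)

  ⇔E₂ : ∀ {Γ φ ψ} → Γ ⊩ φ ⇔· ψ → Γ ⊩ ψ → Γ ⊩ φ
  ⇔E₂ d = ⇒E (∧E₂ d)

  ≐-refl : ∀ {Γ i} → Γ ⊩ i ≐· i
  ≐-refl {Γ} {i} = ⊢⇒⊩ (eq-refl i)

  ≐-sym : ∀ {Γ i j} → Γ ⊩ i ≐· j → Γ ⊩ j ≐· i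
  ≐-sym {Γ} {i} {j} p = ⇒E (⇒E (⊢⇒⊩ (eq-eq i j i)) p) ≐-refl

  ≐-trans : ∀ {Γ i j k} → Γ ⊩ i ≐· j → Γ ⊩ j ≐· k → Γ ⊩ i ≐· k
  ≐-trans {Γ} {i} {j} {k} p q = ⇒E (⇒E (⊢⇒⊩ (eq-eq j i k)) (≐-sym p)) q

  ∈-substˡ : ∀ {Γ i j k} → Γ ⊩ i ≐· j → Γ ⊩ i ∈· k → Γ ⊩ j ∈· k
  ∈-substˡ {Γ} {i} {j} {k} p = ⇒E (⇒E (⊢⇒⊩ (eq-memˡ i j k)) p)

  ∈-substʳ : ∀ {Γ i j k} → Γ ⊩ i ≐· j → Γ ⊩ k ∈· i → Γ ⊩ k ∈· j
  ∈-substʳ {Γ} {i} {j} {k} p = ⇒E (⇒E (⊢⇒⊩ (eq-memʳ i j k)) p)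

  ↑ : List SFm → List SFm
  ↑ = map (rename· suc)

  ∀I : ∀ {Γ φ} → ↑ Γ ⊩ φ → Γ ⊩ ∀· φ
  ∀I {[]}    ⟨ d ⟩ = ⟨ gen d ⟩
  ∀I {A ∷ Γ} {φ} d = ⇒E (⇒E (wk distribute) (wk (∀I (⇒I d)))) (⇒E (wk vacuous) #0)
    where
    distribute : Γ ⊩ ∀· (rename· suc A ⇒· φ) ⇒· ∀· (rename· suc A) ⇒· ∀· φ
    distribute = ⊢⇒⊩ (ax-∀D ⟦ rename· suc A ⟧ ⟦ φ ⟧)
    vacuous : Γ ⊩ A ⇒· ∀· (rename· suc A)
    vacuous = ⊢⇒⊩ (subst (λ X → ⊢ZF ⟦ A ⟧ ⇒ ∀' X) (sym (⟦⟧-rename suc A)) (ax-∀V ⟦ A ⟧))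

  ∀E : ∀ {Γ φ} → Γ ⊩ ∀· φ → (t : ℕ) → Γ ⊩ rename· (inst t) φ
  ∀E {Γ} {φ} d t =
    ⇒E (⊢⇒⊩ (subst (λ X → ⊢ZF ∀' ⟦ φ ⟧ ⇒ X) (sym (⟦⟧-rename (inst t) φ)) (ax-∀E ⟦ φ ⟧ t))) d

  ∃I : ∀ {Γ φ} (t : ℕ) → Γ ⊩ rename· (inst t) φ → Γ ⊩ ∃· φ
  ∃I t d = ⇒I (⇒E (∀E #0 t) (wk d))

  ∃E : ∀ {Γ φ ψ} → Γ ⊩ ∃· φ → (φ ∷ ↑ Γ) ⊩ rename· suc ψ → Γ ⊩ ψ
  ∃E {Γ} {φ} {ψ} e k = ¬¬E (⇒I (⇒E (wk e) (∀I {¬· ψ ∷ Γ} (⇒I (⇒E #1 (⇒E (wk (wk (⇒I k))) #0))))))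

  embed : Fm → SFm
  embed (i ∈' j) = i ∈· j
  embed (i ≐ j)  = i ≐· j
  embed ⊥'       = ⊥·
  embed (φ ⇒ ψ)  = embed φ ⇒· embed ψ
  embed (∀' φ)   = ∀· (embed φ)

  ⟦⟧-embed : ∀ φ → ⟦ embed φ ⟧ ≡ φ
  ⟦⟧-embed (i ∈' j) = refl
  ⟦⟧-embed (i ≐ j)  = refl
  ⟦⟧-embed ⊥'       = refl
  ⟦⟧-embed (φ ⇒ ψ)  = cong₂ _⇒_ (⟦⟧-embed φ) (⟦⟧-embed ψ)
  ⟦⟧-embed (∀' φ)   = cong ∀' (⟦⟧-embed φ)

  Identified : ℕ → ℕ → ℕ → ℕ → Set
  Identified i j a b = a ≡ b ⊎ (a ≡ i × b ≡ j) ⊎ (a ≡ j × b ≡ i)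

  identified-sym : ∀ {i j a b} → Identified i j a b → Identified i j b a
  identified-sym (inj₁ e)                 = inj₁ (sym e)
  identified-sym (inj₂ (inj₁ (e₁ , e₂))) = inj₂ (inj₂ (e₂ , e₁))
  identified-sym (inj₂ (inj₂ (e₁ , e₂))) = inj₂ (inj₁ (e₂ , e₁))

  identified-lift : ∀ {i j ρ σ} → (∀ n → Identified i j (ρ n) (σ n)) →
                    ∀ n → Identified (suc i) (suc j) (lift ρ n) (lift σ n)
  identified-lift r zero = inj₁ refl
  identified-lift r (suc n) with r n
  ... | inj₁ e                 = inj₁ (cong suc e)
  ... | inj₂ (inj₁ (e₁ , e₂)) = inj₂ (inj₁ (cong suc e₁ , cong suc e₂))
  ... | inj₂ (inj₂ (e₁ , e₂)) = inj₂ (inj₂ (cong suc e₁ , cong suc e₂))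

  identified-≐ : ∀ {i j a b} → Identified i j a b → ((i ≐· j) ∷ []) ⊩ a ≐· b
  identified-≐ (inj₁ refl)                 = ≐-refl
  identified-≐ (inj₂ (inj₁ (refl , refl))) = #0
  identified-≐ (inj₂ (inj₂ (refl , refl))) = ≐-sym #0

  ≐-subst-rename : ∀ φ i j ρ σ → (∀ n → Identified i j (ρ n) (σ n)) →
                   ((i ≐· j) ∷ []) ⊩ embed (rename ρ φ) ⇒· embed (rename σ φ)
  ≐-subst-rename (a ∈' b) i j ρ σ r = ⇒I (∈-substʳ (wk (identified-≐ (r b))) (∈-substˡ (wk (identified-≐ (r a))) #0))
  ≐-subst-rename (a ≐ b)  i j ρ σ r = ⇒I (≐-trans (≐-trans (≐-sym (wk (identified-≐ (r a)))) #0) (wk (identified-≐ (r b))))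
  ≐-subst-rename ⊥'       i j ρ σ r = ⇒I #0
  ≐-subst-rename (φ ⇒ ψ)  i j ρ σ r =
    ⇒I (⇒I (⇒E (wk (wk (≐-subst-rename ψ i j ρ σ r)))
               (⇒E #1 (⇒E (wk (wk (≐-subst-rename φ i j σ ρ (λ n → identified-sym (r n))))) #0))))
  ≐-subst-rename (∀' φ)   i j ρ σ r =
    ⇒E (⊢⇒⊩ (ax-∀D ⟦ embed (rename (lift ρ) φ) ⟧ ⟦ embed (rename (lift σ) φ) ⟧))
       (∀I (≐-subst-rename φ (suc i) (suc j) (lift ρ) (lift σ) (identified-lift r)))

  F-substʳ : ∀ {Γ a y z} → Γ ⊩ F· a y → Γ ⊩ y ≐· z → Γ ⊩ F· a z
  F-substʳ {Γ} {a} {y} {z} p q = ⇒E (⇒E (⊢⇒⊩ substitution) q) p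
    where
    identified : ∀ n → Identified y z (args₂ a y n) (args₂ a z n)
    identified zero    = inj₁ refl
    identified (suc n) = inj₂ (inj₁ (refl , refl))
    substitution : ⊢ZF ⟦ (y ≐· z) ⇒· F· a y ⇒· F· a z ⟧
    substitution = subst ⊢ZF_ (cong₂ (λ X Y → (y ≐ z) ⇒ X ⇒ Y) (⟦⟧-embed _) (⟦⟧-embed _))
                     (derivation (≐-subst-rename F y z (args₂ a y) (args₂ a z) identified))

  IsUPair : ℕ → ℕ → ℕ → SFm
  IsUPair t a b = ∀· ((0 ∈· suc t) ⇔· ((0 ≐· suc a) ∨· (0 ≐· suc b)))

  upair-∋ˡ : ∀ {Γ t a b} → Γ ⊩ IsUPair t a b → Γ ⊩ a ∈· t
  upair-∋ˡ {a = a} d = ⇔E₂ (∀E d a) (∨I₁ ≐-refl)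

  upair-∋ʳ : ∀ {Γ t a b} → Γ ⊩ IsUPair t a b → Γ ⊩ b ∈· t
  upair-∋ʳ {b = b} d = ⇔E₂ (∀E d b) (∨I₂ ≐-refl)

  upair-⊆ : ∀ {Γ t a b v} → Γ ⊩ IsUPair t a b → Γ ⊩ v ∈· t → Γ ⊩ (v ≐· a) ∨· (v ≐· b)
  upair-⊆ {v = v} d = ⇔E₁ (∀E d v)

  pairing : ∀ {Γ} → Γ ⊩ ∀· (∀· (∃· ((2 ∈· 0) ∧· (1 ∈· 0))))
  pairing = ⊢⇒⊩ (zf ax-pair)

  separation : ∀ {Γ} φ → Γ ⊩ ∀· (∃· (∀· ((0 ∈· 1) ⇔· ((0 ∈· 2) ∧· rename· sepρ φ))))
  separation φ = ⊢⇒⊩ (subst (λ X → ⊢ZF ∀' (∃' (∀' ((0 ∈' 1) ⇔ ((0 ∈' 2) ∧' X)))))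
                            (sym (⟦⟧-rename sepρ φ)) (zf (ax-sep ⟦ φ ⟧)))

  -- Pairing gives a set containing a and b; Separation cuts it down to {a , b}.
  upair-exists-closed : [] ⊩ ∀· (∀· (∃· (IsUPair 0 2 1)))
  upair-exists-closed =
    ∀I (∀I (∃E (∀E (∀E pairing 1) 0)
             (∃E (∀E (separation ((0 ≐· 3) ∨· (0 ≐· 2))) 0)
               (∃I 0 (∀I (⇔I (⇒I (∧E₂ (⇔E₁ (wk (∀E #0 0)) #0)))
                             (⇒I (⇔E₂ (wk (∀E #0 0))
                                      (∧I (∨E #0 (⇒I (∈-substˡ (≐-sym #0) (∧E₁ #3)))
                                                 (⇒I (∈-substˡ (≐-sym #0) (∧E₂ #3))))
                                          #0)))))))))

  upair-exists : ∀ {Γ} a b → Γ ⊩ ∃· (IsUPair 0 (suc a) (suc b))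
  upair-exists a b = ∀E (∀E (weaken upair-exists-closed) a) b

  -- u = ⟨a , b⟩ = {{a , a} , {a , b}}
  IsOPair : ℕ → ℕ → ℕ → SFm
  IsOPair u a b = ∃· (∃· (IsUPair 1 (2 + a) (2 + a) ∧· (IsUPair 0 (2 + a) (2 + b) ∧· IsUPair (2 + u) 1 0)))

  opair-exists-closed : [] ⊩ ∀· (∀· (∃· (IsOPair 0 2 1)))
  opair-exists-closed =
    ∀I (∀I (∃E (upair-exists 1 1) (∃E (upair-exists 2 1) (∃E (upair-exists 1 0)
      (∃I 0 (∃I 2 (∃I 1 (∧I #2 (∧I #1 #0)))))))))

  opair-exists : ∀ {Γ} a b → Γ ⊩ ∃· (IsOPair 0 (suc a) (suc b))
  opair-exists a b = ∀E (∀E (weaken opair-exists-closed) a) b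

  opair-injˡ : ∀ u a b a' b' → [] ⊩ IsOPair u a b ⇒· IsOPair u a' b' ⇒· (a ≐· a')
  opair-injˡ u a b a' b' = ⇒I (⇒I (∃E #1 (∃E #0 (∃E #2 (∃E #0
    (∨E (upair-⊆ (∧E₁ #2) (∨E (upair-⊆ (∧E₂ (∧E₂ #0)) (upair-∋ˡ (∧E₂ (∧E₂ #2))))
                               (⇒I (∈-substʳ (≐-sym #0) (wk (upair-∋ˡ (∧E₁ #0)))))
                               (⇒I (∈-substʳ (≐-sym #0) (wk (upair-∋ˡ (∧E₁ (∧E₂ #0))))))))
        (⇒I (≐-sym #0)) (⇒I (≐-sym #0))))))))

  -- b' ∈ {a , b'} ∈ ⟨a' , b'⟩ = ⟨a , b⟩, so {a , b'} is {a , a} or {a , b}.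
  opair-injʳ-half : ∀ u a b a' b' → [] ⊩ IsOPair u a b ⇒· IsOPair u a' b' ⇒· ((b' ≐· a) ∨· (b' ≐· b))
  opair-injʳ-half u a b a' b' = ⇒I (⇒I (∃E #1 (∃E #0 (∃E #2 (∃E #0
    (∨E (upair-⊆ (∧E₂ (∧E₂ #2)) (upair-∋ʳ (∧E₂ (∧E₂ #0))))
        (⇒I (∨E (upair-⊆ (wk (∧E₁ #2)) (∈-substʳ #0 (wk (upair-∋ʳ (∧E₁ (∧E₂ #0))))))
                (⇒I (∨I₁ #0)) (⇒I (∨I₁ #0))))
        (⇒I (upair-⊆ (wk (∧E₁ (∧E₂ #2))) (∈-substʳ #0 (wk (upair-∋ʳ (∧E₁ (∧E₂ #0)))))))))))))

  opair-injʳ : ∀ u a b a' b' → [] ⊩ IsOPair u a b ⇒· IsOPair u a' b' ⇒· (b ≐· b')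
  opair-injʳ u a b a' b' = ⇒I (⇒I
    (∨E (⇒E (⇒E (weaken (opair-injʳ-half u a b a' b')) #1) #0)
        (⇒I (∨E (wk (⇒E (⇒E (weaken (opair-injʳ-half u a' b' a b)) #0) #1))
                (⇒I (≐-trans (≐-trans #0 (≐-sym (wk (wk (⇒E (⇒E (weaken (opair-injˡ u a b a' b')) #1) #0)))))
                             (≐-sym #1)))
                (⇒I #0)))
        (⇒I (≐-sym #0))))

  Injective : Set
  Injective = ∀ a b y → [] ⊩ F· a y ⇒· F· b y ⇒· (a ≐· b)

  -- The fibre over y is cut out by Separation from {x , x} if some F x y holds,
  -- and from an arbitrary set otherwise.
  injective⇒small-fibres : Injective → [] ⊩ ∀· (∃· (∀· (F· 0 2 ⇔· (0 ∈· 1))))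
  injective⇒small-fibres injective = ∀I (∨E (excluded-middle {φ = ∃· (F· 0 1)}) (⇒I inhabited) (⇒I empty))
    where
    inhabited : (∃· (F· 0 1) ∷ []) ⊩ ∃· (∀· (F· 0 2 ⇔· (0 ∈· 1)))
    inhabited = ∃E #0 (∃E (upair-exists 0 0) (∃E (∀E (separation (F· 0 3)) 0) (∃I 0 (∀I
      (⇔I (⇒I (⇔E₂ (wk (∀E #0 0))
                    (∧I (∈-substˡ (≐-sym (⇒E (⇒E (weaken (injective 0 3 4)) #0) #3)) (upair-∋ˡ #2)) #0)))
          (⇒I (∧E₂ (⇔E₁ (wk (∀E #0 0)) #0))))))))
    empty : (¬· (∃· (F· 0 1)) ∷ []) ⊩ ∃· (∀· (F· 0 2 ⇔· (0 ∈· 1)))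
    empty = ∃E (upair-exists 0 0) (∃E (∀E (separation (F· 0 2)) 0) (∃I 0 (∀I
      (⇔I (⇒I (⊥E (⇒E #3 (∃I 0 #0))))
          (⇒I (∧E₂ (⇔E₁ (wk (∀E #0 0)) #0)))))))

  module KernelPair (F⇒P : [] ⊩ F· 0 1 ⇒· P· 0)
                    (F-functional : [] ⊩ (F· 0 1 ∧· F· 0 2) ⇒· (1 ≐· 2)) where

    F-dom : ∀ {Γ a y} → Γ ⊩ F· a y → Γ ⊩ P· a
    F-dom {a = a} {y} p = ⇒E (∀E (∀E (weaken (∀I (∀I F⇒P))) y) a) p

    F-unique : ∀ {Γ a y z} → Γ ⊩ F· a y → Γ ⊩ F· a z → Γ ⊩ y ≐· z
    F-unique {a = a} {y} {z} p q = ⇒E (∀E (∀E (∀E (weaken (∀I (∀I (∀I F-functional)))) z) y) a) (∧I p q)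

    SameImage : ℕ → ℕ → SFm
    SameImage a b = ∀· (F· (suc a) 0 ⇔· F· (suc b) 0)

    sameImage : ∀ a b y → [] ⊩ F· a y ⇒· F· b y ⇒· SameImage a b
    sameImage a b y = ⇒I (⇒I (∀I (⇔I (⇒I (F-substʳ #1 (F-unique #2 #0)))
                                     (⇒I (F-substʳ #2 (F-unique #1 #0))))))

    IsKerPair : ℕ → ℕ → ℕ → SFm
    IsKerPair u a b = IsOPair u a b ∧· (SameImage a b ∧· (P· a ∧· P· b))

    -- Ker in context (u), the projections π₁, π₂ in context (u , a)
    Ker π₁ π₂ : SFm
    Ker = ∃· (∃· (IsKerPair 2 1 0))
    π₁  = ∃· (IsKerPair 1 2 0)
    π₂  = ∃· (IsKerPair 1 0 2)

    π₁-total : [] ⊩ π₁ ⇒· (Ker ∧· P· 1)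
    π₁-total = ⇒I (∃E #0 (∧I (∃I 2 (∃I 0 #0)) (∧E₁ (∧E₂ (∧E₂ #0)))))

    π₁-functional : [] ⊩ (π₁ ∧· rename· y→y'' π₁) ⇒· (1 ≐· 2)
    π₁-functional = ⇒I (∃E (∧E₁ #0) (∃E (∧E₂ #1) (⇒E (⇒E (weaken (opair-injˡ _ _ _ _ _)) (∧E₁ #1)) (∧E₁ #0))))

    π₁-defined : [] ⊩ Ker ⇒· ∃· (rename· swap01 π₁)
    π₁-defined = ⇒I #0

    π₂-total : [] ⊩ π₂ ⇒· (Ker ∧· P· 1)
    π₂-total = ⇒I (∃E #0 (∧I (∃I 0 (∃I 2 #0)) (∧E₂ (∧E₂ (∧E₂ #0)))))

    π₂-functional : [] ⊩ (π₂ ∧· rename· y→y'' π₂) ⇒· (1 ≐· 2)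
    π₂-functional = ⇒I (∃E (∧E₁ #0) (∃E (∧E₂ #1) (⇒E (⇒E (weaken (opair-injʳ _ _ _ _ _)) (∧E₁ #1)) (∧E₁ #0))))

    π₂-defined : [] ⊩ Ker ⇒· ∃· (rename· swap01 π₂)
    π₂-defined = ⇒I (∃E #0 (∃E #0 (∃I 0 (∃I 1 #0))))

    π₁⨾F⇔π₂⨾F : [] ⊩ ∃· (rename· swap01 π₁ ∧· F· 0 2) ⇔· ∃· (rename· swap01 π₂ ∧· F· 0 2)
    π₁⨾F⇔π₂⨾F = ⇔I
      (⇒I (∃E #0 (∃E (∧E₁ #0) (∃I 0 (∧I (∃I 1 #0) (⇔E₁ (∀E (∧E₁ (∧E₂ #0)) 3) (∧E₂ #1)))))))
      (⇒I (∃E #0 (∃E (∧E₁ #0) (∃I 0 (∧I (∃I 1 #0) (⇔E₂ (∀E (∧E₁ (∧E₂ #0)) 3) (∧E₂ #1)))))))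

    -- F a y and F b y make ⟨a , b⟩ a point of Ker over which π₁ is a; π₂ = π₁ then forces b = a.
    π₁≡π₂⇒injective : [] ⊩ π₁ ⇔· π₂ → Injective
    π₁≡π₂⇒injective π₁⇔π₂ a b y = ⇒I (⇒I (∃E (opair-exists a b)
      (∃E (⇔E₁ (∀E (∀E (weaken (∀I (∀I π₁⇔π₂))) (suc a)) 0)
               (∃I (suc b) (∧I #0 (∧I (⇒E (⇒E (weaken (sameImage (suc a) (suc b) (suc y))) #2) #1)
                                      (∧I (F-dom #2) (F-dom #1))))))
          (≐-sym (⇒E (⇒E (weaken (opair-injʳ 1 (2 + a) (2 + b) 0 (2 + a))) #1) (∧E₁ #0))))))

module Monomorphism {P Q F : Fm} (P-object : IsObject P) (F-arrow : IsArrow P Q F) where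
  open Schematic P F

  F-freeBelow : FreeBelow 2 F
  F-freeBelow = proj₁ F-arrow

  F⇒P : [] ⊩ F· 0 1 ⇒· P· 0
  F⇒P = ⇒I (∧E₁ {ψ = embed (rename toY Q)} (⇒E (⊢⇒⊩ F⇒P∧Q) #0))
    where
    F⇒P∧Q : ⊢ZF ⟦ F· 0 1 ⇒· (P· 0 ∧· embed (rename toY Q)) ⟧
    F⇒P∧Q = subst ⊢ZF_
      (sym (cong₂ _⇒_ (rename-args₂-id F F-freeBelow)
                      (cong₂ _∧'_ (rename-const-id P P-object) (⟦⟧-embed (rename toY Q)))))
      (proj₁ (proj₂ F-arrow))

  F-functional : [] ⊩ (F· 0 1 ∧· F· 0 2) ⇒· (1 ≐· 2)
  F-functional = ⊢⇒⊩ (subst ⊢ZF_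
    (sym (cong₂ (λ X Y → (X ∧' Y) ⇒ (1 ≐ 2))
                (rename-args₂-id F F-freeBelow)
                (rename-cong₂ F F-freeBelow (args₂ 0 2) y→y'' refl refl)))
    (proj₁ (proj₂ (proj₂ F-arrow))))

  open KernelPair F⇒P F-functional

  isArrow-into-P : ∀ S π → T (freeBelowᵇ 2 π) →
                   [] ⊩ π ⇒· (S ∧· P· 1) →
                   [] ⊩ (π ∧· rename· y→y'' π) ⇒· (1 ≐· 2) →
                   [] ⊩ S ⇒· ∃· (rename· swap01 π) →
                   IsArrow ⟦ S ⟧ P ⟦ π ⟧
  isArrow-into-P S π free total functional defined =
      freeBelowᵇ-sound P-object F-freeBelow 2 π free
    , subst (λ X → ⊢ZF ⟦ π ⟧ ⇒ (⟦ S ⟧ ∧' X)) (rename-cong₁ P P-object (const 1) toY refl) (derivation total)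
    , subst (λ X → ⊢ZF (⟦ π ⟧ ∧' X) ⇒ (1 ≐ 2)) (⟦⟧-rename y→y'' π) (derivation functional)
    , subst (λ X → ⊢ZF ⟦ S ⟧ ⇒ ∃' X) (⟦⟧-rename swap01 π) (derivation defined)

  Ker-object : IsObject ⟦ Ker ⟧
  Ker-object = freeBelowᵇ-sound P-object F-freeBelow 1 Ker tt

  π₁-arrow : IsArrow ⟦ Ker ⟧ P ⟦ π₁ ⟧
  π₁-arrow = isArrow-into-P Ker π₁ tt π₁-total π₁-functional π₁-defined

  π₂-arrow : IsArrow ⟦ Ker ⟧ P ⟦ π₂ ⟧
  π₂-arrow = isArrow-into-P Ker π₂ tt π₂-total π₂-functional π₂-defined

  π₁⨾F≡π₂⨾F : (⟦ π₁ ⟧ ⨾ F) ≡ₐ (⟦ π₂ ⟧ ⨾ F)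
  π₁⨾F≡π₂⨾F = subst ⊢ZF_ (cong₂ _⇔_ (⨾F-schematic π₁) (⨾F-schematic π₂)) (derivation π₁⨾F⇔π₂⨾F)
    where
    ⨾F-schematic : ∀ π → ⟦ ∃· (rename· swap01 π ∧· F· 0 2) ⟧ ≡ ⟦ π ⟧ ⨾ F
    ⨾F-schematic π = cong₂ (λ X Y → ∃' (X ∧' Y)) (⟦⟧-rename swap01 π)
                           (rename-cong₂ F F-freeBelow (args₂ 0 2) compρ₂ refl refl)

  injective⇒isSmall : Injective → IsSmall F
  injective⇒isSmall injective =
    subst (λ X → ⊢ZF ∀' (∃' (∀' (X ⇔ (0 ∈' 1)))))
          (rename-cong₂ F F-freeBelow (args₂ 0 2) smallρ refl refl)
          (derivation (injective⇒small-fibres injective))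

mainTheorem2 : ∀ P Q F → IsObject P → IsObject Q → IsArrow P Q F → IsMono P Q F → IsSmall F
mainTheorem2 P Q F P-object _ F-arrow mono =
  injective⇒isSmall (π₁≡π₂⇒injective ⟨ π₁≡π₂ ⟩)
  where
  open Monomorphism P-object F-arrow
  open Schematic P F
  open KernelPair F⇒P F-functional
  π₁≡π₂ : ⟦ π₁ ⟧ ≡ₐ ⟦ π₂ ⟧
  π₁≡π₂ = mono ⟦ Ker ⟧ ⟦ π₁ ⟧ ⟦ π₂ ⟧ Ker-object π₁-arrow π₂-arrow π₁⨾F≡π₂⨾F
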